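{- For every prime power $q$ and every integer $k\ge 1$ we have $n_q(k,1,2)=n_q(k,2,2)=\lceil 3k/2\rceil$.
   Context: An $[n,k,d]_q$-code is a $k$-dimensional subspace of $\mathbb{F}_q^n$ with minimum Hamming distance at least $d$. A linear code $C\subseteq\mathbb{F}_q^n$ has locality $r$ if for every coordinate $i$ there is a set $S_i\subseteq\{1,\dots,n\}\setminus\{i\}$ with $|S_i|\le r$ such that any two codewords agreeing on all coordinates in $S_i$ also agree in coordinate $i$. $n_q(k,d,r)$ denotes the minimum length $n$ of an $[n,k,d]_q$-code with locality $r$. -}

module Defs where

open import Data.Nat using (ℕ; zero; suc; _≤_; _^_)
open import Data.Nat.Primality using (Prime)
open import Data.Fin using (Fin)
open import Data.Fin.Subset using (Subset; _∈_; _∉_; ∣_∣)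
open import Data.Product using (Σ; ∃; _×_)
open import Relation.Nullary using (¬_; yes; no)
open import Relation.Binary.PropositionalEquality using (_≡_)
open import Relation.Binary.Definitions using (DecidableEquality)
open import Algebra.Structures using (IsCommutativeRing)
open import Function.Bundles using (_↔_)

IsPrimePower : ℕ → Set
IsPrimePower q = Σ ℕ λ p → Σ ℕ λ m → Prime p × (1 ≤ m) × (q ≡ p ^ m)

record FiniteField (q : ℕ) : Set₁ where
  infixl 6 _+_
  infixl 7 _*_
  field
    Carrier : Set
    _+_ _*_ : Carrier → Carrier → Carrier
    -_ : Carrier → Carrier
    0# 1# : Carrier
    isCommutativeRing : IsCommutativeRing _≡_ _+_ _*_ -_ 0# 1#
    0≢1 : ¬ (0# ≡ 1#)
    inverse : ∀ x → ¬ (x ≡ 0#) → Σ Carrier λ y → x * y ≡ 1#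
    _≟_ : DecidableEquality Carrier
    enumeration : Carrier ↔ Fin q

module _ {q : ℕ} (F : FiniteField q) where
  open FiniteField F

  Σ[<_] : (k : ℕ) → (Fin k → Carrier) → Carrier
  Σ[< zero ] f = 0#
  Σ[< suc k ] f = f Fin.zero + Σ[< k ] (λ j → f (Fin.suc j))

  Word : ℕ → Set
  Word n = Fin n → Carrier

  wt : {n : ℕ} → Word n → ℕ
  wt {zero} c = zero
  wt {suc n} c with c Fin.zero ≟ 0#
  ... | yes _ = wt {n} (λ j → c (Fin.suc j))
  ... | no _ = suc (wt {n} (λ j → c (Fin.suc j)))

  record LinearCode (n k : ℕ) : Set where
    field
      gen : Fin k → Word n
      independent : (a : Fin k → Carrier) →
        (∀ i → Σ[< k ] (λ j → a j * gen j i) ≡ 0#) → ∀ j → a j ≡ 0#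

  _∈C_ : {n k : ℕ} → Word n → LinearCode n k → Set
  _∈C_ {n} {k} c C = Σ (Fin k → Carrier) λ a →
    ∀ i → c i ≡ Σ[< k ] (λ j → a j * LinearCode.gen C j i)

  MinDistAtLeast : {n k : ℕ} → LinearCode n k → ℕ → Set
  MinDistAtLeast {n} C d =
    (c c' : Word n) → c ∈C C → c' ∈C C → ∃ (λ i → ¬ (c i ≡ c' i)) →
    d ≤ wt (λ i → c i + - (c' i))

  HasLocality : {n k : ℕ} → LinearCode n k → ℕ → Set
  HasLocality {n} C r = (i : Fin n) → Σ (Subset n) λ S →
    (i ∉ S) × (∣ S ∣ ≤ r) ×
    ((c c' : Word n) → c ∈C C → c' ∈C C →
       (∀ j → j ∈ S → c j ≡ c' j) → c i ≡ c' i)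

  HasCode : (n k d r : ℕ) → Set
  HasCode n k d r = Σ (LinearCode n k) λ C → MinDistAtLeast C d × HasLocality C r

  MinLength : (k d r m : ℕ) → Set
  MinLength k d r m = HasCode m k d r × ((n : ℕ) → HasCode n k d r → m ≤ n)

-- Lower bound: write the code as the image of an injective linear map χ : Fᵏ → Fⁿ and track pairs
-- (V, Z) of a subspace V ⊆ Fᵏ and a set Z of coordinates on which χ vanishes over V, with potential
-- 3 dim V + 2 |Z|, initially 3k. While some coordinate i lies outside Z, cut V down by the coordinate
-- forms of a recovery set S of i (|S| ≤ 2): every new coordinate costs at most one dimension, and χ
-- then vanishes at i as well. So Z gains |S ∖ Z| + 1 elements while dim V drops by at most
-- |S ∖ Z| ≤ 2, and the potential does not decrease. Once Z is everything, V = 0 by injectivity,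
-- hence 3k ≤ 2n.
-- Upper bound: encode each pair (a, b) of message symbols as (a, b, a + b) and a leftover symbol a
-- as (a, a); every coordinate is determined by the other coordinates of its block. Locality alone
-- already forces minimum distance 2.

module Submission where

open import Data.Nat.Base as ℕ using (ℕ; zero; suc; _≤_; _<_; z≤n; s≤s; ⌈_/2⌉)
import Data.Nat.Properties as ℕₚ
open import Data.Fin.Base using (Fin; zero; suc)
open import Data.Fin.Patterns using (0F; 1F; 2F)
open import Data.Fin.Properties using (¬∀⟶∃¬)
open import Data.Fin.Subset using (Subset; _∈_; _∉_; _⊆_; ∣_∣; ⊥; ⁅_⁆; _∪_; ∁; inside; outside)
open import Data.Fin.Subset.Properties
  using (_∈?_; nonempty?; ∉⊥; ∈⊤; ∣⊤∣≡n; ∣⊥∣≡0; ∣p∣≤n; ∣p∣≤∣x∷p∣; ∣⁅x⁆∣≡1; ∣p∣≤∣p∪q∣; p⊂q⇒∣p∣<∣q∣;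
         p⊆p∪q; q⊆p∪q; x∈p∪q⁻; x∈⁅x⁆; x∈⁅y⁆⇒x≡y; x∈∁p⇒x∉p; x∉∁p⇒x∈p)
open import Data.Vec.Base using ([]; _∷_; here; there)
open import Data.Vec.Functional using (Vector; head; tail) renaming (_∷_ to _◂_)
open import Data.Product using (Σ; _×_; _,_; proj₁; proj₂)
open import Data.Sum using (inj₁; inj₂; [_,_])
open import Data.Empty using () renaming (⊥-elim to contradiction)
open import Function.Base using (_∘_)
open import Relation.Nullary using (¬_; yes; no)
open import Relation.Nullary.Decidable using (_→-dec_; decidable-stable)
open import Relation.Binary.PropositionalEquality
  using (_≡_; _≗_; refl; sym; trans; cong; cong₂; subst; module ≡-Reasoning)
open import Algebra.Bundles using (CommutativeRing)
open import Algebra.Structures using (IsCommutativeRing)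
open import Defs

module Arithmetic where
  open import Data.Nat.Base using (_+_; _*_)
  open import Data.Nat.Properties
  open import Data.Nat.Tactic.RingSolver using (solve-∀)

  parityLength : ℕ → ℕ
  parityLength zero = 0
  parityLength (suc zero) = 2
  parityLength (suc (suc k)) = 3 + parityLength k

  parityLength≡⌈3k/2⌉ : ∀ k → parityLength k ≡ ⌈ 3 * k /2⌉
  parityLength≡⌈3k/2⌉ zero = refl
  parityLength≡⌈3k/2⌉ (suc zero) = refl
  parityLength≡⌈3k/2⌉ (suc (suc k)) =
    trans (cong (3 +_) (parityLength≡⌈3k/2⌉ k)) (cong ⌈_/2⌉ (sym (*-distribˡ-+ 3 2 k)))

  potential : ℕ → ℕ → ℕ
  potential k z = 3 * k + 2 * z

  potential-monoʳ : ∀ k {z z′} → z ≤ z′ → potential k z ≤ potential k z′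
  potential-monoʳ k z≤z′ = +-monoʳ-≤ (3 * k) (*-monoʳ-≤ 2 z≤z′)

  potential-≤ : ∀ {k z k′ w} → z + k ≤ w + k′ → w ≤ z + 2 → potential k z ≤ potential k′ (suc w)
  potential-≤ {k} {z} {k′} {w} z+k≤w+k′ w≤z+2 = +-cancelʳ-≤ w _ _ (begin
    3 * k + 2 * z + w         ≤⟨ +-monoʳ-≤ (3 * k + 2 * z) w≤z+2 ⟩
    3 * k + 2 * z + (z + 2)   ≡⟨ regroupˡ k z ⟩
    3 * (z + k) + 2           ≤⟨ +-monoˡ-≤ 2 (*-monoʳ-≤ 3 z+k≤w+k′) ⟩
    3 * (w + k′) + 2          ≡⟨ regroupʳ k′ w ⟩
    3 * k′ + 2 * suc w + w    ∎)
    where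
    open ≤-Reasoning
    regroupˡ : ∀ k z → 3 * k + 2 * z + (z + 2) ≡ 3 * (z + k) + 2
    regroupˡ = solve-∀
    regroupʳ : ∀ k′ w → 3 * (w + k′) + 2 ≡ 3 * k′ + 2 * suc w + w
    regroupʳ = solve-∀

  potential≤2n⇒⌈3k/2⌉≤n : ∀ {k z n} → potential k z ≤ 2 * n → ⌈ 3 * k /2⌉ ≤ n
  potential≤2n⇒⌈3k/2⌉≤n {k} {z} {n} le = begin
    ⌈ 3 * k /2⌉        ≤⟨ ⌈n/2⌉-mono (≤-trans (m≤m+n (3 * k) (2 * z)) le) ⟩
    ⌈ n + (n + 0) /2⌉  ≡⟨ cong (λ m → ⌈ n + m /2⌉) (+-identityʳ n) ⟩
    ⌈ n + n /2⌉        ≡⟨ n≡⌈n+n/2⌉ n ⟨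
    n                  ∎
    where open ≤-Reasoning

open Arithmetic

∣p∪q∣≤∣p∣+∣q∣ : ∀ {n} (p q : Subset n) → ∣ p ∪ q ∣ ≤ ∣ p ∣ ℕ.+ ∣ q ∣
∣p∪q∣≤∣p∣+∣q∣ [] [] = z≤n
∣p∪q∣≤∣p∣+∣q∣ (inside ∷ p) (s ∷ q) =
  s≤s (ℕₚ.≤-trans (∣p∪q∣≤∣p∣+∣q∣ p q) (ℕₚ.+-monoʳ-≤ ∣ p ∣ (∣p∣≤∣x∷p∣ s q)))
∣p∪q∣≤∣p∣+∣q∣ (outside ∷ p) (inside ∷ q) =
  ℕₚ.≤-trans (s≤s (∣p∪q∣≤∣p∣+∣q∣ p q)) (ℕₚ.≤-reflexive (sym (ℕₚ.+-suc ∣ p ∣ ∣ q ∣)))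
∣p∪q∣≤∣p∣+∣q∣ (outside ∷ p) (outside ∷ q) = ∣p∪q∣≤∣p∣+∣q∣ p q

module _ {q : ℕ} (F : FiniteField q) where
  open FiniteField F
  open IsCommutativeRing isCommutativeRing
    using ( +-identityˡ; +-identityʳ; *-identityʳ; zeroˡ; zeroʳ; distribˡ; distribʳ
          ; *-assoc; *-comm; -‿inverseˡ)

  private
    variable
      k k′ n r : ℕ

    commutativeRing : CommutativeRing _ _
    commutativeRing = record { isCommutativeRing = isCommutativeRing }

  open CommutativeRing commutativeRing
    using (ring; semiring; +-commutativeSemigroup; *-commutativeSemigroup)
  open import Algebra.Properties.Ring ring using (+-cancelˡ; +-cancelʳ; -‿distribˡ-*; x∙y⁻¹≈ε⇒x≈y)
  open import Algebra.Properties.Semiring.Sum semiring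
    using (sum; sum-cong-≗; *-distribˡ-sum) renaming (∑-distrib-+ to sum-distrib-+)
  open import Algebra.Properties.CommutativeSemigroup +-commutativeSemigroup using (interchange)
  open import Algebra.Properties.CommutativeSemigroup *-commutativeSemigroup using (x∙yz≈y∙xz)

  ∑ : (k : ℕ) → (Fin k → Carrier) → Carrier
  ∑ = Σ[<_] F

  ∑≡sum : ∀ k (f : Fin k → Carrier) → ∑ k f ≡ sum f
  ∑≡sum zero f = refl
  ∑≡sum (suc k) f = cong (f zero +_) (∑≡sum k (tail f))

  ∑-cong : ∀ k {f g : Fin k → Carrier} → f ≗ g → ∑ k f ≡ ∑ k g
  ∑-cong k {f} {g} f≗g = trans (∑≡sum k f) (trans (sum-cong-≗ f≗g) (sym (∑≡sum k g)))

  ∑-distrib-+ : ∀ k (f g : Fin k → Carrier) → ∑ k (λ j → f j + g j) ≡ ∑ k f + ∑ k g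
  ∑-distrib-+ k f g = begin
    ∑ k (λ j → f j + g j)  ≡⟨ ∑≡sum k _ ⟩
    sum (λ j → f j + g j)  ≡⟨ sum-distrib-+ f g ⟩
    sum f + sum g          ≡⟨ cong₂ _+_ (∑≡sum k f) (∑≡sum k g) ⟨
    ∑ k f + ∑ k g          ∎
    where open ≡-Reasoning

  *-distribˡ-∑ : ∀ k x (f : Fin k → Carrier) → x * ∑ k f ≡ ∑ k (λ j → x * f j)
  *-distribˡ-∑ k x f = begin
    x * ∑ k f              ≡⟨ cong (x *_) (∑≡sum k f) ⟩
    x * sum f              ≡⟨ *-distribˡ-sum x f ⟩
    sum (λ j → x * f j)    ≡⟨ ∑≡sum k _ ⟨
    ∑ k (λ j → x * f j)    ∎
    where open ≡-Reasoning

  infixl 6 _⊕_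
  infixr 7 _⊙_

  _⊕_ : Word F k → Word F k → Word F k
  (a ⊕ b) i = a i + b i

  _⊙_ : Carrier → Word F k → Word F k
  (x ⊙ a) i = x * a i

  𝟎 : Word F k
  𝟎 _ = 0#

  unit : Fin k → Word F k
  unit zero = 1# ◂ 𝟎
  unit (suc j) = 0# ◂ unit j

  record LinearForm (k : ℕ) : Set where
    field
      apply      : Word F k → Carrier
      apply-cong : {a b : Word F k} → a ≗ b → apply a ≡ apply b
      apply-⊕    : ∀ a b → apply (a ⊕ b) ≡ apply a + apply b
      apply-⊙    : ∀ x a → apply (x ⊙ a) ≡ x * apply a

  open LinearForm public

  LinearMap : ℕ → ℕ → Set
  LinearMap k n = Vector (LinearForm k) n

  infixr 8 _⟨$⟩_

  _⟨$⟩_ : LinearMap k n → Word F k → Word F n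
  (χ ⟨$⟩ a) i = apply (χ i) a

  IsZero : LinearForm k → Set
  IsZero f = ∀ a → apply f a ≡ 0#

  apply-𝟎 : (f : LinearForm k) → apply f 𝟎 ≡ 0#
  apply-𝟎 f = begin
    apply f 𝟎          ≡⟨ apply-cong f (λ _ → sym (zeroˡ 0#)) ⟩
    apply f (0# ⊙ 𝟎)   ≡⟨ apply-⊙ f 0# 𝟎 ⟩
    0# * apply f 𝟎     ≡⟨ zeroˡ _ ⟩
    0#                 ∎
    where open ≡-Reasoning

  proj : Fin k → LinearForm k
  proj j = record
    { apply = λ a → a j ; apply-cong = λ a≗b → a≗b j ; apply-⊕ = λ _ _ → refl ; apply-⊙ = λ _ _ → refl }

  0ˡ : LinearForm k
  0ˡ = record
    { apply = λ _ → 0# ; apply-cong = λ _ → refl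
    ; apply-⊕ = λ _ _ → sym (+-identityˡ 0#) ; apply-⊙ = λ x _ → sym (zeroʳ x) }

  infixl 6 _+ˡ_
  infixr 7 _·ˡ_
  infixr 9 _∘ˡ_ _∘ₘ_

  _+ˡ_ : LinearForm k → LinearForm k → LinearForm k
  f +ˡ g = record
    { apply = λ a → apply f a + apply g a
    ; apply-cong = λ a≗b → cong₂ _+_ (apply-cong f a≗b) (apply-cong g a≗b)
    ; apply-⊕ = λ a b → trans (cong₂ _+_ (apply-⊕ f a b) (apply-⊕ g a b)) (interchange _ _ _ _)
    ; apply-⊙ = λ x a → trans (cong₂ _+_ (apply-⊙ f x a) (apply-⊙ g x a)) (sym (distribˡ x _ _)) }

  _·ˡ_ : Carrier → LinearForm k → LinearForm k
  c ·ˡ f = record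
    { apply = λ a → c * apply f a
    ; apply-cong = λ a≗b → cong (c *_) (apply-cong f a≗b)
    ; apply-⊕ = λ a b → trans (cong (c *_) (apply-⊕ f a b)) (distribˡ c _ _)
    ; apply-⊙ = λ x a → trans (cong (c *_) (apply-⊙ f x a)) (x∙yz≈y∙xz c x _) }

  _∘ˡ_ : LinearForm k → LinearMap k′ k → LinearForm k′
  f ∘ˡ ψ = record
    { apply = λ a → apply f (ψ ⟨$⟩ a)
    ; apply-cong = λ a≗b → apply-cong f (λ j → apply-cong (ψ j) a≗b)
    ; apply-⊕ = λ a b → trans (apply-cong f (λ j → apply-⊕ (ψ j) a b)) (apply-⊕ f _ _)
    ; apply-⊙ = λ x a → trans (apply-cong f (λ j → apply-⊙ (ψ j) x a)) (apply-⊙ f _ _) }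

  _∘ₘ_ : LinearMap k n → LinearMap k′ k → LinearMap k′ n
  (χ ∘ₘ ψ) i = χ i ∘ˡ ψ

  prepend0 : LinearMap k (suc k)
  prepend0 = 0ˡ ◂ proj

  tailForm : LinearForm (suc k) → LinearForm k
  tailForm f = f ∘ˡ prepend0

  apply-decompose : (f : LinearForm (suc k)) (a : Word F (suc k)) →
    apply f a ≡ head a * apply f (unit zero) + apply (tailForm f) (tail a)
  apply-decompose f a = begin
    apply f a                                           ≡⟨ apply-cong f split ⟩
    apply f (head a ⊙ unit zero ⊕ prepend0 ⟨$⟩ tail a)  ≡⟨ apply-⊕ f _ _ ⟩
    apply f (head a ⊙ unit zero) + g                    ≡⟨ cong (_+ g) (apply-⊙ f _ _) ⟩
    head a * apply f (unit zero) + g                    ∎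
    where
    open ≡-Reasoning
    g = apply (tailForm f) (tail a)
    split : a ≗ head a ⊙ unit zero ⊕ prepend0 ⟨$⟩ tail a
    split zero = sym (trans (+-identityʳ _) (*-identityʳ _))
    split (suc j) = sym (trans (cong (_+ a (suc j)) (zeroʳ _)) (+-identityˡ _))

  apply≡∑ : (f : LinearForm k) (a : Word F k) → apply f a ≡ ∑ k (λ j → a j * apply f (unit j))
  apply≡∑ {zero} f a = trans (apply-cong f (λ ())) (apply-𝟎 f)
  apply≡∑ {suc k} f a = begin
    apply f a                                               ≡⟨ apply-decompose f a ⟩
    head a * apply f (unit zero) + apply (tailForm f) (tail a)
      ≡⟨ cong (head a * apply f (unit zero) +_) (apply≡∑ (tailForm f) (tail a)) ⟩
    head a * apply f (unit zero) + ∑ k (λ j → a (suc j) * apply (tailForm f) (unit j))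
      ≡⟨ cong (head a * apply f (unit zero) +_)
              (∑-cong k (λ j → cong (a (suc j) *_) (apply-cong f (prepend0-unit j)))) ⟩
    ∑ (suc k) (λ j → a j * apply f (unit j))                ∎
    where
    open ≡-Reasoning
    prepend0-unit : (j : Fin k) → prepend0 ⟨$⟩ unit j ≗ unit (suc j)
    prepend0-unit j zero = refl
    prepend0-unit j (suc l) = refl

  TrivialKernel : LinearMap k n → Set
  TrivialKernel χ = ∀ a → χ ⟨$⟩ a ≗ 𝟎 → a ≗ 𝟎

  ∘ₘ-trivialKernel : (χ : LinearMap k n) (ψ : LinearMap k′ k) →
    TrivialKernel χ → TrivialKernel ψ → TrivialKernel (χ ∘ₘ ψ)
  ∘ₘ-trivialKernel χ ψ χ-tk ψ-tk a χψa≗𝟎 = ψ-tk a (χ-tk (ψ ⟨$⟩ a) χψa≗𝟎)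

  zero-trivialKernel⇒k≡0 : (χ : LinearMap k n) → (∀ i → IsZero (χ i)) → TrivialKernel χ → k ≡ 0
  zero-trivialKernel⇒k≡0 {zero} χ χ≡0 χ-tk = refl
  zero-trivialKernel⇒k≡0 {suc k} χ χ≡0 χ-tk =
    contradiction (0≢1 (sym (χ-tk (unit zero) (λ i → χ≡0 i (unit zero)) zero)))

  -- A d-dimensional subspace of Fᵏ is represented by an injective linear map Fᵈ → Fᵏ.
  record Subspace (k : ℕ) : Set where
    field
      dim                 : ℕ
      embed               : LinearMap dim k
      embed-trivialKernel : TrivialKernel embed

  open Subspace public

  whole : Subspace k
  whole = record { dim = _ ; embed = proj ; embed-trivialKernel = λ _ a≗𝟎 → a≗𝟎 }

  infixr 9 _∘ₛ_

  _∘ₛ_ : (V : Subspace k) → Subspace (dim V) → Subspace k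
  V ∘ₛ W = record
    { dim = dim W
    ; embed = embed V ∘ₘ embed W
    ; embed-trivialKernel =
        ∘ₘ-trivialKernel (embed V) (embed W) (embed-trivialKernel V) (embed-trivialKernel W) }

  graph : LinearForm k → Subspace (suc k)
  graph t = record { dim = _ ; embed = t ◂ proj ; embed-trivialKernel = λ _ h j → h (suc j) }

  extend : Subspace k → Subspace (suc k)
  extend V = record
    { dim = suc (dim V)
    ; embed = proj zero ◂ embed V ∘ₘ (proj ∘ suc)
    ; embed-trivialKernel = trivialKernel }
    where
    trivialKernel : TrivialKernel (proj zero ◂ embed V ∘ₘ (proj ∘ suc))
    trivialKernel a h zero = h zero
    trivialKernel a h (suc j) = embed-trivialKernel V (tail a) (h ∘ suc) j

  -- ker f is the graph of −f(e₀)⁻¹·f(0,−) when f(e₀) ≠ 0, and F × ker f(0,−) otherwise.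
  kernel : (f : LinearForm k) → Σ (Subspace k) λ V → k ≤ suc (dim V) × IsZero (f ∘ˡ embed V)
  kernel {zero} f = whole , z≤n , λ b → trans (apply-cong f (λ ())) (apply-𝟎 f)
  kernel {suc k} f with apply f (unit zero) ≟ 0#
  ... | no f₀≢0 = graph (- y ·ˡ g) , ℕₚ.≤-refl , vanishes
    where
    open ≡-Reasoning
    f₀ = apply f (unit zero)
    g = tailForm f
    y = proj₁ (inverse f₀ f₀≢0)
    y*[x*f₀]≡x : ∀ x → y * (x * f₀) ≡ x
    y*[x*f₀]≡x x = begin
      y * (x * f₀)  ≡⟨ *-comm y _ ⟩
      x * f₀ * y    ≡⟨ *-assoc x f₀ y ⟩
      x * (f₀ * y)  ≡⟨ cong (x *_) (proj₂ (inverse f₀ f₀≢0)) ⟩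
      x * 1#        ≡⟨ *-identityʳ x ⟩
      x             ∎
    vanishes : IsZero (f ∘ˡ embed (graph (- y ·ˡ g)))
    vanishes b = begin
      apply f (embed (graph (- y ·ˡ g)) ⟨$⟩ b)   ≡⟨ apply-decompose f _ ⟩
      - y * apply g b * f₀ + apply g b           ≡⟨ cong (_+ apply g b) (*-assoc (- y) _ f₀) ⟩
      - y * (apply g b * f₀) + apply g b         ≡⟨ cong (_+ apply g b) (-‿distribˡ-* y _) ⟨
      - (y * (apply g b * f₀)) + apply g b       ≡⟨ cong (λ x → - x + apply g b) (y*[x*f₀]≡x _) ⟩
      - apply g b + apply g b                    ≡⟨ -‿inverseˡ _ ⟩
      0#                                         ∎
  ... | yes f₀≡0 with kernel (tailForm f)
  ...   | V , k≤1+dimV , gV≡0 = extend V , s≤s k≤1+dimV , vanishes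
    where
    open ≡-Reasoning
    vanishes : IsZero (f ∘ˡ embed (extend V))
    vanishes b = begin
      apply f (embed (extend V) ⟨$⟩ b)
        ≡⟨ apply-decompose f _ ⟩
      head b * apply f (unit zero) + apply (tailForm f ∘ˡ embed V) (tail b)
        ≡⟨ cong₂ _+_ (cong (head b *_) f₀≡0) (gV≡0 (tail b)) ⟩
      head b * 0# + 0#  ≡⟨ +-identityʳ _ ⟩
      head b * 0#       ≡⟨ zeroʳ _ ⟩
      0#                ∎

  VanishesOn : LinearMap k n → Subset n → Set
  VanishesOn χ Z = ∀ {i} → i ∈ Z → IsZero (χ i)

  VanishesOn-∪⁅⁆ : {χ : LinearMap k n} {Z : Subset n} {i : Fin n} →
    VanishesOn χ Z → IsZero (χ i) → VanishesOn χ (Z ∪ ⁅ i ⁆)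
  VanishesOn-∪⁅⁆ {Z = Z} {i} χZ χi j∈Z∪i with x∈p∪q⁻ Z ⁅ i ⁆ j∈Z∪i
  ... | inj₁ j∈Z = χZ j∈Z
  ... | inj₂ j∈⁅i⁆ rewrite x∈⁅y⁆⇒x≡y i j∈⁅i⁆ = χi

  vanishingSubspace : (χ : LinearMap k n) (Z S : Subset n) → VanishesOn χ Z →
    Σ (Subspace k) λ V → ∣ Z ∣ ℕ.+ k ≤ ∣ Z ∪ S ∣ ℕ.+ dim V × VanishesOn (χ ∘ₘ embed V) (Z ∪ S)
  vanishingSubspace χ [] [] _ = whole , ℕₚ.≤-refl , λ ()
  vanishingSubspace χ (inside ∷ Z) (_ ∷ S) χZ
    with vanishingSubspace (tail χ) Z S (χZ ∘ there)
  ... | V , ≤dimV , χVZS =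
    V , s≤s ≤dimV , λ { here b → χZ here (embed V ⟨$⟩ b) ; (there j∈) → χVZS j∈ }
  vanishingSubspace χ (outside ∷ Z) (outside ∷ S) χZ
    with vanishingSubspace (tail χ) Z S (χZ ∘ there)
  ... | V , ≤dimV , χVZS = V , ≤dimV , λ { (there j∈) → χVZS j∈ }
  vanishingSubspace {k} χ (outside ∷ Z) (inside ∷ S) χZ
    with kernel (χ zero)
  ... | V₁ , k≤1+dimV₁ , χ₀V₁≡0
    with vanishingSubspace (tail χ ∘ₘ embed V₁) Z S (λ j∈ b → χZ (there j∈) (embed V₁ ⟨$⟩ b))
  ... | V₂ , ≤dimV₂ , χV₁V₂ZS =
    V₁ ∘ₛ V₂ , dim≤ , λ { here b → χ₀V₁≡0 (embed V₂ ⟨$⟩ b) ; (there j∈) → χV₁V₂ZS j∈ }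
    where
    dim≤ : ∣ Z ∣ ℕ.+ k ≤ suc (∣ Z ∪ S ∣ ℕ.+ dim V₂)
    dim≤ = ℕₚ.≤-trans (ℕₚ.+-monoʳ-≤ ∣ Z ∣ k≤1+dimV₁)
             (ℕₚ.≤-trans (ℕₚ.≤-reflexive (ℕₚ.+-suc ∣ Z ∣ (dim V₁))) (s≤s ≤dimV₂))

  Recovers : LinearMap k n → Subset n → Fin n → Set
  Recovers {k} {n} χ S i = (a a′ : Word F k) →
    ((j : Fin n) → j ∈ S → (χ ⟨$⟩ a) j ≡ (χ ⟨$⟩ a′) j) → (χ ⟨$⟩ a) i ≡ (χ ⟨$⟩ a′) i

  IsLocal : ℕ → LinearMap k n → Set
  IsLocal {n = n} r χ = (i : Fin n) → Σ (Subset n) λ S → i ∉ S × ∣ S ∣ ≤ r × Recovers χ S i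

  recovered-vanishes : {χ : LinearMap k n} {S T : Subset n} {i : Fin n} (ψ : LinearMap k′ k) →
    Recovers χ S i → S ⊆ T → VanishesOn (χ ∘ₘ ψ) T → IsZero (χ i ∘ˡ ψ)
  recovered-vanishes {χ = χ} {i = i} ψ recover S⊆T χψT b = begin
    apply (χ i) (ψ ⟨$⟩ b)
      ≡⟨ recover (ψ ⟨$⟩ b) 𝟎 (λ j j∈S → trans (χψT (S⊆T j∈S) b) (sym (apply-𝟎 (χ j)))) ⟩
    apply (χ i) 𝟎         ≡⟨ apply-𝟎 (χ i) ⟩
    0#                    ∎
    where open ≡-Reasoning

  module _ (χ : LinearMap k n) (χ-trivialKernel : TrivialKernel χ) (χ-local : IsLocal 2 χ) where

    -- m bounds the number of coordinates outside Z.
    potential-bound : ∀ m (V : Subspace k) (Z : Subset n) → VanishesOn (χ ∘ₘ embed V) Z →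
      n ≤ m ℕ.+ ∣ Z ∣ → potential (dim V) ∣ Z ∣ ≤ 2 ℕ.* n
    potential-bound m V Z χVZ n≤m+∣Z∣ with nonempty? (∁ Z)
    potential-bound m V Z χVZ n≤m+∣Z∣ | no ∁Z-empty =
      subst (λ d → potential d ∣ Z ∣ ≤ 2 ℕ.* n) (sym dimV≡0) (ℕₚ.*-monoʳ-≤ 2 (∣p∣≤n Z))
      where
      Z-full : ∀ i → i ∈ Z
      Z-full i = x∉∁p⇒x∈p (λ i∈∁Z → ∁Z-empty (i , i∈∁Z))
      dimV≡0 : dim V ≡ 0
      dimV≡0 = zero-trivialKernel⇒k≡0 (χ ∘ₘ embed V) (λ i → χVZ (Z-full i))
                 (∘ₘ-trivialKernel χ (embed V) χ-trivialKernel (embed-trivialKernel V))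
    potential-bound zero V Z χVZ n≤∣Z∣ | yes (i , i∈∁Z) =
      contradiction (ℕₚ.<⇒≱ ∣Z∣<n n≤∣Z∣)
      where
      ∣Z∣<n : ∣ Z ∣ < n
      ∣Z∣<n = subst (∣ Z ∣ <_) (∣⊤∣≡n n) (p⊂q⇒∣p∣<∣q∣ ((λ _ → ∈⊤) , i , ∈⊤ , x∈∁p⇒x∉p i∈∁Z))
    potential-bound (suc m) V Z χVZ n≤1+m+∣Z∣ | yes (i , i∈∁Z)
      with χ-local i
    ... | S , i∉S , ∣S∣≤2 , recover
      with vanishingSubspace (χ ∘ₘ embed V) Z S χVZ
    ... | W , ≤dimW , χVWZS = begin
      potential (dim V) ∣ Z ∣             ≤⟨ potential-≤ ≤dimW ∣Z∪S∣≤∣Z∣+2 ⟩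
      potential (dim W) (suc ∣ Z ∪ S ∣)   ≤⟨ potential-monoʳ (dim W) ∣Z∪S∣<∣Z′∣ ⟩
      potential (dim W) ∣ Z′ ∣            ≤⟨ potential-bound m (V ∘ₛ W) Z′ χV′Z′ n≤m+∣Z′∣ ⟩
      2 ℕ.* n                             ∎
      where
      open ℕₚ.≤-Reasoning
      Z′ = (Z ∪ S) ∪ ⁅ i ⁆
      ∣Z∪S∣≤∣Z∣+2 : ∣ Z ∪ S ∣ ≤ ∣ Z ∣ ℕ.+ 2
      ∣Z∪S∣≤∣Z∣+2 = ℕₚ.≤-trans (∣p∪q∣≤∣p∣+∣q∣ Z S) (ℕₚ.+-monoʳ-≤ ∣ Z ∣ ∣S∣≤2)
      i∉Z∪S : i ∉ Z ∪ S
      i∉Z∪S i∈Z∪S = [ x∈∁p⇒x∉p i∈∁Z , i∉S ] (x∈p∪q⁻ Z S i∈Z∪S)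
      ∣Z∪S∣<∣Z′∣ : ∣ Z ∪ S ∣ < ∣ Z′ ∣
      ∣Z∪S∣<∣Z′∣ = p⊂q⇒∣p∣<∣q∣ (p⊆p∪q ⁅ i ⁆ , i , q⊆p∪q (Z ∪ S) ⁅ i ⁆ (x∈⁅x⁆ i) , i∉Z∪S)
      n≤m+∣Z′∣ : n ≤ m ℕ.+ ∣ Z′ ∣
      n≤m+∣Z′∣ = ℕₚ.≤-trans n≤1+m+∣Z∣ (ℕₚ.≤-trans (ℕₚ.≤-reflexive (sym (ℕₚ.+-suc m ∣ Z ∣)))
                   (ℕₚ.+-monoʳ-≤ m (ℕₚ.≤-<-trans (∣p∣≤∣p∪q∣ Z S) ∣Z∪S∣<∣Z′∣)))
      χV′Z′ : VanishesOn (χ ∘ₘ embed (V ∘ₛ W)) Z′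
      χV′Z′ = VanishesOn-∪⁅⁆ {χ = χ ∘ₘ embed (V ∘ₛ W)} χVWZS
                (recovered-vanishes {χ = χ} (embed (V ∘ₛ W)) recover (λ j∈S → q⊆p∪q Z S j∈S) χVWZS)

  generatorMap : LinearCode F n k → LinearMap k n
  generatorMap {k = k} C i = record
    { apply = λ a → ∑ k (λ j → a j * gen j i)
    ; apply-cong = λ a≗b → ∑-cong k (λ j → cong (_* gen j i) (a≗b j))
    ; apply-⊕ = λ a b → trans (∑-cong k (λ j → distribʳ (gen j i) (a j) (b j))) (∑-distrib-+ k _ _)
    ; apply-⊙ = λ x a → trans (∑-cong k (λ j → *-assoc x (a j) (gen j i)))
                              (sym (*-distribˡ-∑ k x (λ j → a j * gen j i))) }
    where open LinearCode C

  generatorMap-local : (C : LinearCode F n k) → HasLocality F C r → IsLocal r (generatorMap C)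
  generatorMap-local C C-local i =
    let S , i∉S , ∣S∣≤r , recover = C-local i
    in S , i∉S , ∣S∣≤r , λ a a′ → recover _ _ (a , λ _ → refl) (a′ , λ _ → refl)

  imageCode : (χ : LinearMap k n) → TrivialKernel χ → LinearCode F n k
  imageCode χ χ-trivialKernel = record
    { gen = λ j i → apply (χ i) (unit j)
    ; independent = λ a ∑≡0 → χ-trivialKernel a (λ i → trans (apply≡∑ (χ i) a) (∑≡0 i)) }

  ∈imageCode : (χ : LinearMap k n) (χ-tk : TrivialKernel χ) {c : Word F n} →
    (c∈ : _∈C_ F c (imageCode χ χ-tk)) → c ≗ χ ⟨$⟩ proj₁ c∈
  ∈imageCode χ _ (a , c≡∑) i = trans (c≡∑ i) (sym (apply≡∑ (χ i) a))

  imageCode-local : (χ : LinearMap k n) (χ-tk : TrivialKernel χ) → IsLocal r χ →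
    HasLocality F (imageCode χ χ-tk) r
  imageCode-local χ χ-tk χ-local i =
    let S , i∉S , ∣S∣≤r , recover = χ-local i
    in S , i∉S , ∣S∣≤r , λ c c′ c∈ c′∈ c≡c′|S → begin
      c i                      ≡⟨ image c∈ i ⟩
      (χ ⟨$⟩ proj₁ c∈) i       ≡⟨ recover _ _ (λ j j∈S → begin
                                    (χ ⟨$⟩ proj₁ c∈) j    ≡⟨ image c∈ j ⟨
                                    c j                   ≡⟨ c≡c′|S j j∈S ⟩
                                    c′ j                  ≡⟨ image c′∈ j ⟩
                                    (χ ⟨$⟩ proj₁ c′∈) j   ∎) ⟩
      (χ ⟨$⟩ proj₁ c′∈) i      ≡⟨ image c′∈ i ⟨
      c′ i                     ∎
    where
    open ≡-Reasoning
    image = ∈imageCode χ χ-tk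

  ∣S∣≤wt : (w : Word F n) (S : Subset n) → (∀ {j} → j ∈ S → ¬ w j ≡ 0#) → ∣ S ∣ ≤ wt F w
  ∣S∣≤wt {zero} w [] _ = z≤n
  ∣S∣≤wt {suc n} w (s ∷ S) S≢0 with w zero ≟ 0#
  ∣S∣≤wt {suc n} w (inside ∷ S) S≢0 | yes w₀≡0 = contradiction (S≢0 here w₀≡0)
  ∣S∣≤wt {suc n} w (outside ∷ S) S≢0 | yes _ = ∣S∣≤wt (tail w) S (S≢0 ∘ there)
  ∣S∣≤wt {suc n} w (inside ∷ S) S≢0 | no _ = s≤s (∣S∣≤wt (tail w) S (S≢0 ∘ there))
  ∣S∣≤wt {suc n} w (outside ∷ S) S≢0 | no _ = ℕₚ.m≤n⇒m≤1+n (∣S∣≤wt (tail w) S (S≢0 ∘ there))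

  2≤wt : (w : Word F n) {i j : Fin n} → ¬ i ≡ j → ¬ w i ≡ 0# → ¬ w j ≡ 0# → 2 ≤ wt F w
  2≤wt w {i} {j} i≢j wᵢ≢0 wⱼ≢0 = ℕₚ.≤-trans 2≤∣⁅i,j⁆∣ (∣S∣≤wt w (⁅ i ⁆ ∪ ⁅ j ⁆) nonzero)
    where
    2≤∣⁅i,j⁆∣ : 2 ≤ ∣ ⁅ i ⁆ ∪ ⁅ j ⁆ ∣
    2≤∣⁅i,j⁆∣ = subst (_< ∣ ⁅ i ⁆ ∪ ⁅ j ⁆ ∣) (∣⁅x⁆∣≡1 i)
      (p⊂q⇒∣p∣<∣q∣ (p⊆p∪q ⁅ j ⁆ , j , q⊆p∪q ⁅ i ⁆ ⁅ j ⁆ (x∈⁅x⁆ j) , i≢j ∘ sym ∘ x∈⁅y⁆⇒x≡y i))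
    nonzero : ∀ {l} → l ∈ ⁅ i ⁆ ∪ ⁅ j ⁆ → ¬ w l ≡ 0#
    nonzero {l} l∈ with x∈p∪q⁻ ⁅ i ⁆ ⁅ j ⁆ l∈
    ... | inj₁ l∈⁅i⁆ rewrite x∈⁅y⁆⇒x≡y i l∈⁅i⁆ = wᵢ≢0
    ... | inj₂ l∈⁅j⁆ rewrite x∈⁅y⁆⇒x≡y j l∈⁅j⁆ = wⱼ≢0

  -- Two codewords differing at i also differ somewhere on a recovery set of i, which avoids i.
  local⇒minDist≥2 : (C : LinearCode F n k) → HasLocality F C r → MinDistAtLeast F C 2
  local⇒minDist≥2 {n = n} C C-local c c′ c∈ c′∈ (i , cᵢ≢c′ᵢ) with C-local i
  ... | S , i∉S , _ , recover
    with ¬∀⟶∃¬ n (λ j → j ∈ S → c j ≡ c′ j) (λ j → j ∈? S →-dec c j ≟ c′ j)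
           (cᵢ≢c′ᵢ ∘ recover c c′ c∈ c′∈)
  ... | j , ¬[j∈S⇒cⱼ≡c′ⱼ] = 2≤wt _ i≢j (difference≢0 cᵢ≢c′ᵢ) (difference≢0 cⱼ≢c′ⱼ)
    where
    j∈S : j ∈ S
    j∈S = decidable-stable (j ∈? S) (λ j∉S → ¬[j∈S⇒cⱼ≡c′ⱼ] (contradiction ∘ j∉S))
    cⱼ≢c′ⱼ : ¬ c j ≡ c′ j
    cⱼ≢c′ⱼ cⱼ≡c′ⱼ = ¬[j∈S⇒cⱼ≡c′ⱼ] (λ _ → cⱼ≡c′ⱼ)
    i≢j : ¬ i ≡ j
    i≢j refl = i∉S j∈S
    difference≢0 : ∀ {x y} → ¬ x ≡ y → ¬ x + - y ≡ 0#
    difference≢0 {x} {y} x≢y = x≢y ∘ x∙y⁻¹≈ε⇒x≈y x y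

  parityEncoder : ∀ k → LinearMap k (parityLength k)
  parityEncoder zero = λ ()
  parityEncoder (suc zero) = proj 0F ◂ proj 0F ◂ λ ()
  parityEncoder (suc (suc k)) =
    proj 0F ◂ proj 1F ◂ proj 0F +ˡ proj 1F ◂ parityEncoder k ∘ₘ (λ j → proj (suc (suc j)))

  parityEncoder-trivialKernel : ∀ k → TrivialKernel (parityEncoder k)
  parityEncoder-trivialKernel (suc zero) a h 0F = h 0F
  parityEncoder-trivialKernel (suc (suc k)) a h 0F = h 0F
  parityEncoder-trivialKernel (suc (suc k)) a h 1F = h 1F
  parityEncoder-trivialKernel (suc (suc k)) a h (suc (suc j)) =
    parityEncoder-trivialKernel k (tail (tail a)) (λ i → h (suc (suc (suc i)))) j

  parityEncoder-local : ∀ k → IsLocal 2 (parityEncoder k)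
  parityEncoder-local (suc zero) 0F = ⁅ 1F ⁆ , (λ ()) , s≤s z≤n , λ _ _ agree → agree 1F (there here)
  parityEncoder-local (suc zero) 1F = ⁅ 0F ⁆ , (λ { (there ()) }) , s≤s z≤n , λ _ _ agree → agree 0F here
  parityEncoder-local (suc (suc k)) 0F =
    outside ∷ inside ∷ inside ∷ ⊥ , (λ ()) , ∣two∣≤2 , λ a a′ agree →
      +-cancelʳ (a 1F) (a 0F) (a′ 0F)
        (trans (agree 2F (there (there here))) (cong (a′ 0F +_) (sym (agree 1F (there here)))))
    where ∣two∣≤2 = s≤s (s≤s (ℕₚ.≤-reflexive (∣⊥∣≡0 (parityLength k))))
  parityEncoder-local (suc (suc k)) 1F =
    inside ∷ outside ∷ inside ∷ ⊥ , (λ { (there ()) }) , ∣two∣≤2 , λ a a′ agree →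
      +-cancelˡ (a 0F) (a 1F) (a′ 1F)
        (trans (agree 2F (there (there here))) (cong (_+ a′ 1F) (sym (agree 0F here))))
    where ∣two∣≤2 = s≤s (s≤s (ℕₚ.≤-reflexive (∣⊥∣≡0 (parityLength k))))
  parityEncoder-local (suc (suc k)) 2F =
    inside ∷ inside ∷ outside ∷ ⊥ , (λ { (there (there ())) }) , ∣two∣≤2 , λ a a′ agree →
      cong₂ _+_ (agree 0F here) (agree 1F (there here))
    where ∣two∣≤2 = s≤s (s≤s (ℕₚ.≤-reflexive (∣⊥∣≡0 (parityLength k))))
  parityEncoder-local (suc (suc k)) (suc (suc (suc i))) =
    let S , i∉S , ∣S∣≤2 , recover = parityEncoder-local k i
    in outside ∷ outside ∷ outside ∷ S , (λ { (there (there (there i∈S))) → i∉S i∈S }) , ∣S∣≤2 ,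
       λ a a′ agree → recover (tail (tail a)) (tail (tail a′))
                        (λ j j∈S → agree (suc (suc (suc j))) (there (there (there j∈S))))

-- Imported only here: inside the module above, _*_ is the multiplication of F.
open import Data.Nat using (ℕ; _≤_; _*_; ⌈_/2⌉)
open import Data.Product using (_×_)

lowerBound : ∀ {q} (F : FiniteField q) {n k d} → HasCode F n k d 2 → ⌈ 3 * k /2⌉ ≤ n
lowerBound F {n} {k} (C , _ , C-local) = potential≤2n⇒⌈3k/2⌉≤n {k} {∣ ⊥ {n = n} ∣}
  (potential-bound F (generatorMap F C) (LinearCode.independent C) (generatorMap-local F C C-local)
    n (whole F) ⊥ (contradiction ∘ ∉⊥) (ℕₚ.m≤m+n n _))

upperBound : ∀ {q} (F : FiniteField q) k {d} → d ≤ 2 → HasCode F ⌈ 3 * k /2⌉ k d 2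
upperBound F k d≤2 = subst (λ n → HasCode F n k _ 2) (parityLength≡⌈3k/2⌉ k)
  (C , (λ c c′ c∈ c′∈ c≢c′ → ℕₚ.≤-trans d≤2 (local⇒minDist≥2 F C C-local c c′ c∈ c′∈ c≢c′)) , C-local)
  where
  χ-tk = parityEncoder-trivialKernel F k
  C = imageCode F (parityEncoder F k) χ-tk
  C-local = imageCode-local F (parityEncoder F k) χ-tk (parityEncoder-local F k)

corollary15 : (q : ℕ) → IsPrimePower q → (F : FiniteField q) → (k : ℕ) → 1 ≤ k →
    MinLength F k 1 2 ⌈ 3 * k /2⌉ × MinLength F k 2 2 ⌈ 3 * k /2⌉
corollary15 q _ F k _ =
  (upperBound F k (s≤s z≤n) , λ _ → lowerBound F) , (upperBound F k ℕₚ.≤-refl , λ _ → lowerBound F)
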